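{- Fix $k \geq 2$. There is a constant $c_k$ such that for all $n$, if $G = (V,E)$ is a $k$-hypergraph with $|V| = n$ and edge pseudo-density $p$, then for every integer $u$ with $c_k \leq u \leq n$ there exists a subset $U \subseteq V$ with $|U|=u$ and $e(U) \geq 0.99\, p\, u^k$.
   Context: A $k$-hypergraph $G=(V,E)$ consists of a finite set $V$ of vertices and a finite set $E$ of hyperedges, each hyperedge $e\in E$ being associated to a set $i(e)$ of exactly $k$ distinct vertices of $V$; distinct hyperedges may be associated to the same set of vertices. The edge pseudo-density of $G$ is $p=|E|/|V|^k$. For $U\subseteq V$, $E(U)$ is the set of hyperedges $e$ with $i(e)\subseteq U$, and $e(U)=|E(U)|$. -}

module Defs where

open import Data.Nat using (ℕ; zero; suc; _+_)
open import Data.Fin using (Fin; zero; suc)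
open import Data.Fin.Subset using (Subset; _⊆_; ∣_∣)
open import Data.Fin.Subset.Properties using (_⊆?_)
open import Data.Product using (Σ; proj₁)
open import Relation.Binary.PropositionalEquality using (_≡_)
open import Relation.Nullary using (yes; no)

-- A k-hypergraph on vertex set V = Fin n: a finite family of hyperedges,
-- indexed by Fin m (so |E| = m; distinct hyperedges may share vertex sets),
-- each hyperedge e associated to a set i(e) of exactly k distinct vertices.
record Hypergraph (k n : ℕ) : Set where
  field
    m   : ℕ
    inc : Fin m → Subset n
    inc-size : (e : Fin m) → ∣ inc e ∣ ≡ k

open Hypergraph public

countIn : {n : ℕ} (m : ℕ) → (Fin m → Subset n) → Subset n → ℕ
countIn zero    f U = 0
countIn (suc m) f U with f zero ⊆? U
... | yes _ = suc (countIn m (λ e → f (suc e)) U)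
... | no  _ = countIn m (λ e → f (suc e)) U

numEdges : {k n : ℕ} → Hypergraph k n → ℕ
numEdges G = m G

eU : {k n : ℕ} → Hypergraph k n → Subset n → ℕ
eU G U = countIn (m G) (inc G) U

module Submission where

-- For a vertex set U with |U| = s + 1,
-- every hyperedge inside U survives the deletion of exactly the s + 1 - k
-- vertices of U outside it, so  Σ_{v ∈ U} e(U - v) = (s + 1 - k) e(U).
-- Hence some vertex v has  (s + 1) e(U - v) ≥ (s + 1 - k) e(U), i.e. the
-- quantity e(U) / |U|^(k) (with x^(k) the falling factorial) does not decrease
-- when v is deleted.  Deleting vertices one at a time from V down to size u
-- gives W with |W| = u and  e(W) n^(k) ≥ |E| u^(k).  Finally n^(k) ≤ n^k, and
-- by Bernoulli's inequality u^(k) ≥ (u - k)^k ≥ u^k (1 - k²/u) ≥ 0.99 u^k as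
-- soon as u ≥ 100 k², so c_k = 100 k² works.

open import Defs
open import Function using (_∘_)
open import Data.Bool using (if_then_else_)
open import Data.Nat using (ℕ; zero; suc; _+_; _*_; _^_; _∸_; _≤_; _<_; z≤n; s≤s; NonZero; >-nonZero; z<s)
open import Data.Nat.Properties
open import Data.Nat.Combinatorics.Base using (_P′_)
open import Data.Nat.Combinatorics.Specification using (nP′k≡n[n∸1P′k∸1])
open import Data.Nat.Solver using (module +-*-Solver)
open import Data.Fin using (Fin; zero; suc)
open import Data.Fin.Subset using (Subset; ∣_∣; _∈_; _⊆_; _-_; _─_; ⊤; ⊥; inside; outside)
open import Data.Fin.Subset.Properties using (_⊆?_; p⊆q⇒∣p∣≤∣q∣; p─⊥≡p; ⊆⊤; ∣⊤∣≡n)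
open import Data.Vec using ([]; _∷_; here; there)
open import Data.Product using (Σ; Σ-syntax; _×_; _,_)
open import Data.Sum using (inj₁; inj₂)
open import Relation.Nullary using (Dec; does; yes; no; contradiction)
open import Relation.Binary.PropositionalEquality
open import Algebra.Properties.CommutativeSemigroup +-commutativeSemigroup
  using () renaming (interchange to +-interchange)
open import Algebra.Properties.CommutativeSemigroup *-commutativeSemigroup
  using (x∙yz≈yx∙z; x∙yz≈y∙xz; x∙yz≈z∙xy; x∙yz≈z∙yx; x∙yz≈xz∙y; xy∙z≈y∙xz; xy∙z≈x∙zy)
open +-*-Solver using (solve; _:+_; _:*_; _:=_; con)

indicator : {P : Set} → Dec P → ℕ
indicator d = if does d then 1 else 0

sumOver : {n : ℕ} → Subset n → (Fin n → ℕ) → ℕ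
sumOver []            g = 0
sumOver (inside  ∷ U) g = g zero + sumOver U (g ∘ suc)
sumOver (outside ∷ U) g = sumOver U (g ∘ suc)

sumOver-cong : ∀ {n} (U : Subset n) {g h : Fin n → ℕ} → (∀ v → g v ≡ h v) → sumOver U g ≡ sumOver U h
sumOver-cong []            g≡h = refl
sumOver-cong (inside  ∷ U) g≡h = cong₂ _+_ (g≡h zero) (sumOver-cong U (g≡h ∘ suc))
sumOver-cong (outside ∷ U) g≡h = sumOver-cong U (g≡h ∘ suc)

sumOver-+ : ∀ {n} (U : Subset n) (g h : Fin n → ℕ) →
  sumOver U (λ v → g v + h v) ≡ sumOver U g + sumOver U h
sumOver-+ []            g h = refl
sumOver-+ (inside  ∷ U) g h = begin
    (g zero + h zero) + sumOver U (λ v → g (suc v) + h (suc v))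
  ≡⟨ cong ((g zero + h zero) +_) (sumOver-+ U (g ∘ suc) (h ∘ suc)) ⟩
    (g zero + h zero) + (sumOver U (g ∘ suc) + sumOver U (h ∘ suc))
  ≡⟨ +-interchange (g zero) (h zero) _ _ ⟩
    (g zero + sumOver U (g ∘ suc)) + (h zero + sumOver U (h ∘ suc))
  ∎
  where open ≡-Reasoning
sumOver-+ (outside ∷ U) g h = sumOver-+ U (g ∘ suc) (h ∘ suc)

sumOver-zero : ∀ {n} (U : Subset n) (g : Fin n → ℕ) → (∀ v → g v ≡ 0) → sumOver U g ≡ 0
sumOver-zero []            g g≡0 = refl
sumOver-zero (inside  ∷ U) g g≡0 = cong₂ _+_ (g≡0 zero) (sumOver-zero U (g ∘ suc) (g≡0 ∘ suc))
sumOver-zero (outside ∷ U) g g≡0 = sumOver-zero U (g ∘ suc) (g≡0 ∘ suc)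

sumOver-empty : ∀ {n} (U : Subset n) (g : Fin n → ℕ) → ∣ U ∣ ≡ 0 → sumOver U g ≡ 0
sumOver-empty []            g _       = refl
sumOver-empty (outside ∷ U) g ∣U∣≡0 = sumOver-empty U (g ∘ suc) ∣U∣≡0

average-attained : ∀ {n} (U : Subset n) (g : Fin n → ℕ) → 0 < ∣ U ∣ →
  Σ[ v ∈ Fin n ] (v ∈ U × sumOver U g ≤ ∣ U ∣ * g v)
average-attained (outside ∷ U) g 0<∣U∣ with average-attained U (g ∘ suc) 0<∣U∣
... | v , v∈U , avg = suc v , there v∈U , avg
average-attained (inside ∷ U) g _ with 0 <? ∣ U ∣
... | no ∣U∣≯0 = zero , here ,
  +-monoʳ-≤ (g zero) (≤-trans (≤-reflexive (sumOver-empty U (g ∘ suc) (n≤0⇒n≡0 (≮⇒≥ ∣U∣≯0)))) z≤n)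
... | yes 0<∣U∣ with average-attained U (g ∘ suc) 0<∣U∣
...   | v , v∈U , avg with ≤-total (g (suc v)) (g zero)
...     | inj₁ gv≤g0 = zero , here , +-monoʳ-≤ (g zero) (≤-trans avg (*-monoʳ-≤ ∣ U ∣ gv≤g0))
...     | inj₂ g0≤gv = suc v , there v∈U , +-mono-≤ g0≤gv avg

countIn-suc : ∀ {n} m (f : Fin (suc m) → Subset n) (U : Subset n) →
  countIn (suc m) f U ≡ indicator (f zero ⊆? U) + countIn m (f ∘ suc) U
countIn-suc m f U with f zero ⊆? U
... | yes _ = refl
... | no  _ = refl

-- Deleting one vertex of U keeps a set A ⊆ U inside exactly for the
-- |U| - |A| vertices outside A:  Σ_{v ∈ U} [A ⊆ U - v] = [A ⊆ U] (|U| - |A|).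
deletions-keeping : ∀ {n} (A U : Subset n) →
  sumOver U (λ v → indicator (A ⊆? U - v)) ≡ indicator (A ⊆? U) * (∣ U ∣ ∸ ∣ A ∣)
deletions-keeping []            []            = refl
deletions-keeping (outside ∷ A) (outside ∷ U) = deletions-keeping A U
deletions-keeping (inside  ∷ A) (outside ∷ U) = sumOver-zero U _ (λ _ → refl)
deletions-keeping (inside  ∷ A) (inside  ∷ U) = deletions-keeping A U
deletions-keeping (outside ∷ A) (inside  ∷ U) = begin
    indicator (A ⊆? U ─ ⊥) + sumOver U (λ v → indicator (A ⊆? U - v))
  ≡⟨ cong₂ _+_ (cong (indicator ∘ (A ⊆?_)) (p─⊥≡p U)) (deletions-keeping A U) ⟩
    indicator (A ⊆? U) + indicator (A ⊆? U) * (∣ U ∣ ∸ ∣ A ∣)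
  ≡⟨ absorb (A ⊆? U) ⟩
    indicator (A ⊆? U) * (suc ∣ U ∣ ∸ ∣ A ∣)
  ∎
  where
  open ≡-Reasoning
  -- the vertex 0 ∈ U lies outside A, so it is one more admissible deletion
  absorb : (d : Dec (A ⊆ U)) → indicator d + indicator d * (∣ U ∣ ∸ ∣ A ∣) ≡ indicator d * (suc ∣ U ∣ ∸ ∣ A ∣)
  absorb (yes A⊆U) = begin
      1 + ((∣ U ∣ ∸ ∣ A ∣) + 0)
    ≡⟨ cong suc (+-identityʳ _) ⟩
      suc (∣ U ∣ ∸ ∣ A ∣)
    ≡⟨ +-∸-assoc 1 (p⊆q⇒∣p∣≤∣q∣ A⊆U) ⟨
      suc ∣ U ∣ ∸ ∣ A ∣
    ≡⟨ +-identityʳ _ ⟨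
      (suc ∣ U ∣ ∸ ∣ A ∣) + 0
    ∎
  absorb (no _) = refl

deletion-double-count : ∀ {n k} m (f : Fin m → Subset n) → (∀ e → ∣ f e ∣ ≡ k) → (U : Subset n) →
  sumOver U (λ v → countIn m f (U - v)) ≡ countIn m f U * (∣ U ∣ ∸ k)
deletion-double-count zero    f size U = sumOver-zero U _ (λ _ → refl)
deletion-double-count {k = k} (suc m) f size U = begin
    sumOver U (λ v → countIn (suc m) f (U - v))
  ≡⟨ sumOver-cong U (λ v → countIn-suc m f (U - v)) ⟩
    sumOver U (λ v → indicator (f zero ⊆? U - v) + countIn m (f ∘ suc) (U - v))
  ≡⟨ sumOver-+ U _ _ ⟩
    sumOver U (λ v → indicator (f zero ⊆? U - v)) + sumOver U (λ v → countIn m (f ∘ suc) (U - v))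
  ≡⟨ cong₂ _+_ (deletions-keeping (f zero) U) (deletion-double-count m (f ∘ suc) (size ∘ suc) U) ⟩
    indicator (f zero ⊆? U) * (∣ U ∣ ∸ ∣ f zero ∣) + countIn m (f ∘ suc) U * (∣ U ∣ ∸ k)
  ≡⟨ cong (λ j → indicator (f zero ⊆? U) * (∣ U ∣ ∸ j) + countIn m (f ∘ suc) U * (∣ U ∣ ∸ k)) (size zero) ⟩
    indicator (f zero ⊆? U) * (∣ U ∣ ∸ k) + countIn m (f ∘ suc) U * (∣ U ∣ ∸ k)
  ≡⟨ *-distribʳ-+ (∣ U ∣ ∸ k) (indicator (f zero ⊆? U)) _ ⟨
    (indicator (f zero ⊆? U) + countIn m (f ∘ suc) U) * (∣ U ∣ ∸ k)
  ≡⟨ cong (_* (∣ U ∣ ∸ k)) (countIn-suc m f U) ⟨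
    countIn (suc m) f U * (∣ U ∣ ∸ k)
  ∎
  where open ≡-Reasoning

∣p-x∣+1≡∣p∣ : ∀ {n} {p : Subset n} {x : Fin n} → x ∈ p → suc ∣ p - x ∣ ≡ ∣ p ∣
∣p-x∣+1≡∣p∣ {p = inside  ∷ p} here        = cong suc (cong ∣_∣ (p─⊥≡p p))
∣p-x∣+1≡∣p∣ {p = inside  ∷ p} (there x∈p) = cong suc (∣p-x∣+1≡∣p∣ x∈p)
∣p-x∣+1≡∣p∣ {p = outside ∷ p} (there x∈p) = ∣p-x∣+1≡∣p∣ x∈p

-- One deletion step: a set U of size s + 1 has a vertex whose deletion
-- keeps  e(U - v) / s^(k)  ≥  e(U) / (s+1)^(k), in the form
-- (s + 1 - k) e(U) ≤ (s + 1) e(U - v).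
delete-vertex : ∀ {k n} (G : Hypergraph k n) (s : ℕ) (U : Subset n) → ∣ U ∣ ≡ suc s →
  Σ[ v ∈ Fin n ] (∣ U - v ∣ ≡ s × eU G U * (suc s ∸ k) ≤ suc s * eU G (U - v))
delete-vertex {k} G s U ∣U∣≡1+s with average-attained U (λ v → eU G (U - v)) (subst (0 <_) (sym ∣U∣≡1+s) z<s)
... | v , v∈U , avg = v , suc-injective (trans (∣p-x∣+1≡∣p∣ v∈U) ∣U∣≡1+s) ,
  subst₂ _≤_ (trans (deletion-double-count (m G) (inc G) (inc-size G) U) (cong (λ t → eU G U * (t ∸ k)) ∣U∣≡1+s))
             (cong (_* eU G (U - v)) ∣U∣≡1+s) avg

P′-suc : ∀ s k → (suc s P′ k) * (suc s ∸ k) ≡ suc s * (s P′ k)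
P′-suc s k = trans (*-comm (suc s P′ k) (suc s ∸ k)) (nP′k≡n[n∸1P′k∸1] (suc s) (suc k))

descend : ∀ {k n} (G : Hypergraph k n) {u : ℕ} → k ≤ u → ∀ s (U : Subset n) → ∣ U ∣ ≡ s → u ≤ s →
  Σ[ W ∈ Subset n ] (∣ W ∣ ≡ u × eU G U * (u P′ k) ≤ eU G W * (s P′ k))
descend G {u} k≤u s U ∣U∣≡s u≤s with m≤n⇒m<n∨m≡n u≤s
descend {k} G {u} k≤u s U ∣U∣≡s u≤s | inj₂ u≡s =
  U , trans ∣U∣≡s (sym u≡s) , ≤-reflexive (cong (λ t → eU G U * (t P′ k)) u≡s)
descend {k} G {u} k≤u (suc s) U ∣U∣≡s u≤s | inj₁ (s≤s u≤s') with delete-vertex G s U ∣U∣≡s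
... | v , ∣U-v∣≡s , one-step with descend G k≤u s (U - v) ∣U-v∣≡s u≤s'
... | W , ∣W∣≡u , descent = W , ∣W∣≡u , *-cancelˡ-≤ a {{a≢0}} (begin
    a * (eU G U * (u P′ k))                 ≡⟨ x∙yz≈yx∙z a (eU G U) (u P′ k) ⟩
    (eU G U * a) * (u P′ k)                 ≤⟨ *-monoˡ-≤ (u P′ k) one-step ⟩
    (suc s * eU G (U - v)) * (u P′ k)       ≡⟨ *-assoc (suc s) (eU G (U - v)) (u P′ k) ⟩
    suc s * (eU G (U - v) * (u P′ k))       ≤⟨ *-monoʳ-≤ (suc s) descent ⟩
    suc s * (eU G W * (s P′ k))             ≡⟨ x∙yz≈y∙xz (suc s) (eU G W) (s P′ k) ⟩
    eU G W * (suc s * (s P′ k))             ≡⟨ cong (eU G W *_) (P′-suc s k) ⟨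
    eU G W * ((suc s P′ k) * a)             ≡⟨ x∙yz≈z∙xy (eU G W) (suc s P′ k) a ⟩
    a * (eU G W * (suc s P′ k))             ∎)
  where
  open ≤-Reasoning
  a : ℕ
  a = suc s ∸ k
  a≢0 : NonZero a
  a≢0 = >-nonZero (subst (0 <_) (sym (+-∸-assoc 1 (≤-trans k≤u u≤s'))) z<s)

P′≤^ : ∀ n k → n P′ k ≤ n ^ k
P′≤^ n zero    = ≤-refl
P′≤^ n (suc k) = *-mono-≤ (m∸n≤m n k) (P′≤^ n k)

[n∸k]^k≤P′ : ∀ n k → (n ∸ k) ^ k ≤ n P′ k
[n∸k]^k≤P′ n zero    = ≤-refl
[n∸k]^k≤P′ n (suc k) = *-mono-≤ n∸k+1≤n∸k (≤-trans (^-monoˡ-≤ k n∸k+1≤n∸k) ([n∸k]^k≤P′ n k))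
  where
  n∸k+1≤n∸k : n ∸ suc k ≤ n ∸ k
  n∸k+1≤n∸k = ∸-monoʳ-≤ n (n≤1+n k)

-- (1 - a/y)(1 - b/y) ≥ 1 - (a + b)/y, cleared of denominators; this is the
-- inductive step of Bernoulli's inequality.
two-step : ∀ y a b → y * (y ∸ (a + b)) ≤ (y ∸ a) * (y ∸ b)
two-step y a b with a + b ≤? y
... | no a+b≰y = ≤-trans (≤-reflexive (trans (cong (y *_) (m≤n⇒m∸n≡0 (<⇒≤ (≰⇒> a+b≰y)))) (*-zeroʳ y))) z≤n
... | yes a+b≤y with m≤n⇒∃[o]m+o≡n a+b≤y
... | r , refl = begin
    (a + b + r) * (a + b + r ∸ (a + b))  ≡⟨ cong ((a + b + r) *_) (m+n∸m≡n (a + b) r) ⟩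
    (a + b + r) * r                      ≤⟨ m≤m+n _ (a * b) ⟩
    (a + b + r) * r + a * b              ≡⟨ expand a b r ⟩
    (b + r) * (a + r)                    ≡⟨ cong₂ _*_ y∸a y∸b ⟨
    (a + b + r ∸ a) * (a + b + r ∸ b)    ∎
  where
  open ≤-Reasoning
  expand : ∀ a b r → (a + b + r) * r + a * b ≡ (b + r) * (a + r)
  expand = solve 3 (λ a b r → (a :+ b :+ r) :* r :+ a :* b := (b :+ r) :* (a :+ r)) refl
  y∸a : a + b + r ∸ a ≡ b + r
  y∸a = trans (cong (_∸ a) (+-assoc a b r)) (m+n∸m≡n a (b + r))
  y∸b : a + b + r ∸ b ≡ a + r
  y∸b = trans (cong (λ t → t + r ∸ b) (+-comm a b)) (trans (cong (_∸ b) (+-assoc b a r)) (m+n∸m≡n b (a + r)))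

-- Bernoulli's inequality (1 - d/y)^j ≥ 1 - jd/y, cleared of denominators.
bernoulli : ∀ y d j → y ^ j * (y ∸ j * d) ≤ y * (y ∸ d) ^ j
bernoulli y d zero    = ≤-reflexive (trans (*-identityˡ y) (sym (*-identityʳ y)))
bernoulli y d (suc j) = begin
    (y * y ^ j) * (y ∸ (d + j * d))  ≡⟨ xy∙z≈y∙xz y (y ^ j) _ ⟩
    y ^ j * (y * (y ∸ (d + j * d)))  ≤⟨ *-monoʳ-≤ (y ^ j) (two-step y d (j * d)) ⟩
    y ^ j * ((y ∸ d) * (y ∸ j * d))  ≡⟨ x∙yz≈xz∙y (y ^ j) (y ∸ d) (y ∸ j * d) ⟩
    (y ^ j * (y ∸ j * d)) * (y ∸ d)  ≤⟨ *-monoˡ-≤ (y ∸ d) (bernoulli y d j) ⟩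
    (y * (y ∸ d) ^ j) * (y ∸ d)      ≡⟨ xy∙z≈x∙zy y ((y ∸ d) ^ j) (y ∸ d) ⟩
    y * ((y ∸ d) * (y ∸ d) ^ j)      ∎
  where open ≤-Reasoning

linear-margin : ∀ c {K u} → suc c * K ≤ u → c * u ≤ suc c * (u ∸ K)
linear-margin c {K} c+1·K≤u with m≤n⇒∃[o]m+o≡n c+1·K≤u
... | r , refl = begin
    c * (K + c * K + r)            ≤⟨ m≤m+n _ r ⟩
    c * (K + c * K + r) + r        ≡⟨ expand c K r ⟩
    suc c * (c * K + r)            ≡⟨ cong (suc c *_) u∸K ⟨
    suc c * (K + c * K + r ∸ K)    ∎
  where
  open ≤-Reasoning
  expand : ∀ c K r → c * (K + c * K + r) + r ≡ suc c * (c * K + r)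
  expand = solve 3 (λ c K r → c :* (K :+ c :* K :+ r) :+ r := (con 1 :+ c) :* (c :* K :+ r)) refl
  u∸K : K + c * K + r ∸ K ≡ c * K + r
  u∸K = trans (cong (_∸ K) (+-assoc K (c * K) r)) (m+n∸m≡n K (c * K + r))

falling-ratio : ∀ c k u .{{_ : NonZero u}} → suc c * (k * k) ≤ u → c * u ^ k ≤ suc c * (u P′ k)
falling-ratio c k u bound = *-cancelˡ-≤ u (begin
    u * (c * u ^ k)                ≡⟨ x∙yz≈z∙yx u c (u ^ k) ⟩
    u ^ k * (c * u)                ≤⟨ *-monoʳ-≤ (u ^ k) (linear-margin c bound) ⟩
    u ^ k * (suc c * (u ∸ k * k))  ≡⟨ x∙yz≈y∙xz (u ^ k) (suc c) _ ⟩
    suc c * (u ^ k * (u ∸ k * k))  ≤⟨ *-monoʳ-≤ (suc c) (bernoulli u k k) ⟩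
    suc c * (u * (u ∸ k) ^ k)      ≤⟨ *-monoʳ-≤ (suc c) (*-monoʳ-≤ u ([n∸k]^k≤P′ u k)) ⟩
    suc c * (u * (u P′ k))         ≡⟨ x∙yz≈y∙xz (suc c) u (u P′ k) ⟩
    u * (suc c * (u P′ k))         ∎)
  where open ≤-Reasoning

countIn-⊤ : ∀ {n} m (f : Fin m → Subset n) → countIn m f ⊤ ≡ m
countIn-⊤ zero    f = refl
countIn-⊤ (suc m) f with f zero ⊆? ⊤
... | yes _      = cong suc (countIn-⊤ m (f ∘ suc))
... | no  f0⊈⊤ = contradiction (λ {v} → ⊆⊤ {x = v}) f0⊈⊤

k≤[1+c]k² : ∀ c {k u} → 1 ≤ k → suc c * (k * k) ≤ u → k ≤ u
k≤[1+c]k² c {k} 1≤k bound = ≤-trans (m≤m*n k k {{>-nonZero 1≤k}}) (≤-trans (m≤n*m (k * k) (suc c)) bound)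

-- The theorem with a general density loss 1/(c + 1): once u ≥ (c + 1) k², some
-- u-set U has e(U) ≥ (c/(c+1)) p u^k, where p = |E| / n^k.
dense-subset : ∀ c {k n} (G : Hypergraph k n) {u : ℕ} → 1 ≤ k → suc c * (k * k) ≤ u → u ≤ n →
  Σ[ U ∈ Subset n ] (∣ U ∣ ≡ u × c * numEdges G * u ^ k ≤ suc c * eU G U * n ^ k)
dense-subset c {k} {n} G {u} 1≤k bound u≤n with descend G (k≤[1+c]k² c 1≤k bound) n ⊤ (∣⊤∣≡n n) u≤n
... | W , ∣W∣≡u , descent = W , ∣W∣≡u , (begin
    c * numEdges G * u ^ k           ≡⟨ xy∙z≈y∙xz c (numEdges G) (u ^ k) ⟩
    numEdges G * (c * u ^ k)         ≤⟨ *-monoʳ-≤ (numEdges G) (falling-ratio c k u {{u≢0}} bound) ⟩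
    numEdges G * (suc c * (u P′ k))  ≡⟨ x∙yz≈y∙xz (numEdges G) (suc c) (u P′ k) ⟩
    suc c * (numEdges G * (u P′ k))  ≡⟨ cong (λ e → suc c * (e * (u P′ k))) (countIn-⊤ (m G) (inc G)) ⟨
    suc c * (eU G ⊤ * (u P′ k))      ≤⟨ *-monoʳ-≤ (suc c) descent ⟩
    suc c * (eU G W * (n P′ k))      ≤⟨ *-monoʳ-≤ (suc c) (*-monoʳ-≤ (eU G W) (P′≤^ n k)) ⟩
    suc c * (eU G W * n ^ k)         ≡⟨ *-assoc (suc c) (eU G W) (n ^ k) ⟨
    suc c * eU G W * n ^ k           ∎)
  where
  open ≤-Reasoning
  u≢0 : NonZero u
  u≢0 = >-nonZero (≤-trans 1≤k (k≤[1+c]k² c 1≤k bound))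

lemma17 : (k : ℕ) → 2 ≤ k →
    Σ ℕ (λ c → (n : ℕ) (G : Hypergraph k n) (u : ℕ) → c ≤ u → u ≤ n →
      Σ (Subset n) (λ U → (∣ U ∣ ≡ u) × (99 * numEdges G * u ^ k ≤ 100 * eU G U * n ^ k)))
lemma17 k 2≤k = 100 * (k * k) , λ n G u c≤u u≤n → dense-subset 99 G (≤-trans (s≤s z≤n) 2≤k) c≤u u≤n
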